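{- Let $s$ be a nonnegative integer and let $G$ be an imperfect pseudo-split graph with pseudo-split partition $(C,S,I)$. Then $G$ is an $(s,\infty)$-polar graph if and only if either $s>|C|$, or $|C|\ge s\ge 2$ and there are at least $|C|-s+2$ vertices of $G$ with degree exactly $|C|+4$.
   Context: All graphs are finite and simple. A pseudo-split partition of a graph $G$ is a partition $(C,S,I)$ of $V_G$ such that $C$ is a clique, $I$ is an independent set, either $S=\varnothing$ or $G[S]\cong C_5$, $C$ is completely adjacent to $S$ (every vertex of $C$ is adjacent to every vertex of $S$), and $I$ is completely nonadjacent to $S$ (no edges between $I$ and $S$). A graph is pseudo-split if it admits such a partition; it is imperfect pseudo-split if it admits one with $S\neq\varnothing$ (in which case the partition is unique). For a nonnegative integer $s$ (or $s=\infty$) and a nonnegative integer $k$ (or $k=\infty$), an $(s,k)$-polar partition of $G$ is a partition $(A,B)$ of $V_G$ such that $G[A]$ is a complete multipartite graph with at most $s$ parts and $G[B]$ is a disjoint union of at most $k$ complete graphs, where $\infty$ means no restriction on the number of parts/components. $G$ is $(s,k)$-polar if it admits such a partition. -}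

module Defs where

open import Data.Nat using (ℕ; zero; suc; _+_; _≤_)
open import Data.Fin using (Fin; zero; suc)
open import Data.Bool using (Bool; true; false; if_then_else_)
open import Data.Product using (Σ; _×_; ∃)
open import Function.Bundles using (_⇔_)
open import Relation.Binary.PropositionalEquality using (_≡_; _≢_)
open import Relation.Nullary using (¬_)

record Graph (n : ℕ) : Set where
  field
    adj    : Fin n → Fin n → Bool
    sym    : ∀ u v → adj u v ≡ adj v u
    irrefl : ∀ v → adj v v ≡ false
open Graph public

count : ∀ {n} → (Fin n → Bool) → ℕ
count {zero}  P = 0
count {suc n} P = (if P zero then 1 else 0) + count (λ i → P (suc i))

degree : ∀ {n} → Graph n → Fin n → ℕ
degree G v = count (adj G v)

data Part : Set where
  partC partS partI : Part

isC : Part → Bool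
isC partC = true
isC _     = false

Adjacent : ∀ {n} → Graph n → Fin n → Fin n → Set
Adjacent G u v = adj G u v ≡ true

next5 : Fin 5 → Fin 5
next5 zero = suc zero
next5 (suc zero) = suc (suc zero)
next5 (suc (suc zero)) = suc (suc (suc zero))
next5 (suc (suc (suc zero))) = suc (suc (suc (suc zero)))
next5 (suc (suc (suc (suc zero)))) = zero

C5adj : Fin 5 → Fin 5 → Set
C5adj i j = (next5 i ≡ j) Data.Sum.⊎ (next5 j ≡ i)
  where import Data.Sum

-- G[S] ≅ C5, where S = { v | L v ≡ partS }: a bijection σ from Fin 5 onto S
-- carrying C5-adjacency exactly to G-adjacency.
InducedC5 : ∀ {n} → Graph n → (Fin n → Part) → Set
InducedC5 {n} G L =
  Σ (Fin 5 → Fin n) λ σ →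
      (∀ i j → σ i ≡ σ j → i ≡ j)
    × (∀ i → L (σ i) ≡ partS)
    × (∀ v → L v ≡ partS → ∃ λ i → σ i ≡ v)
    × (∀ i j → Adjacent G (σ i) (σ j) ⇔ C5adj i j)

-- (C,S,I) is a pseudo-split partition with S ≠ ∅ (so G[S] ≅ C5):
-- C clique, I independent, G[S] ≅ C5, C complete to S, I anticomplete to S.
IsImperfectPseudoSplitPartition : ∀ {n} → Graph n → (Fin n → Part) → Set
IsImperfectPseudoSplitPartition G L =
    (∀ u v → L u ≡ partC → L v ≡ partC → u ≢ v → Adjacent G u v)
  × (∀ u v → L u ≡ partI → L v ≡ partI → ¬ Adjacent G u v)
  × InducedC5 G L
  × (∀ u v → L u ≡ partC → L v ≡ partS → Adjacent G u v)
  × (∀ u v → L u ≡ partI → L v ≡ partS → ¬ Adjacent G u v)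

-- G[A] (A = { v | inA v ≡ true }) is complete multipartite with at most s parts:
-- the vertices of A can be assigned to s parts so that two distinct vertices
-- of A are adjacent iff they lie in different parts.
CompleteMultipartiteAtMost : ∀ {n} → Graph n → (Fin n → Bool) → ℕ → Set
CompleteMultipartiteAtMost {n} G inA s =
  Σ ((v : Fin n) → inA v ≡ true → Fin s) λ p →
    ∀ u v (hu : inA u ≡ true) (hv : inA v ≡ true) → u ≢ v →
      Adjacent G u v ⇔ (p u hu ≢ p v hv)

-- G[B] (B = { v | inA v ≡ false }) is a disjoint union of (any number of)
-- complete graphs: vertices of B can be labelled so that two distinct
-- vertices of B are adjacent iff they carry the same label.
DisjointUnionOfCliques : ∀ {n} → Graph n → (Fin n → Bool) → Set
DisjointUnionOfCliques {n} G inA =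
  Σ (Fin n → ℕ) λ q →
    ∀ u v → inA u ≡ false → inA v ≡ false → u ≢ v →
      Adjacent G u v ⇔ (q u ≡ q v)

IsSInfPolar : ∀ {n} → Graph n → ℕ → Set
IsSInfPolar {n} G s =
  Σ (Fin n → Bool) λ inA →
    CompleteMultipartiteAtMost G inA s × DisjointUnionOfCliques G inA

{-# OPTIONS --safe #-}
-- Let c = |C|. Counting neighbours class by class, a vertex of C has degree
-- c + 4 plus its number of neighbours in I, a vertex of S has degree c + 2 and
-- a vertex of I has degree at most c; so the vertices of degree c + 4 are exactly
-- the vertices of C without a neighbour in I.
--
-- Let (A, B) be an (s,∞)-polar partition. G[A] has no induced K₁ ∪ K₂ and G[B] no
-- induced P₃, so the 5-cycle G[S] meets both sides. If A contains an edge ab of the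
-- cycle and B a vertex d of it, then (C ∩ A) ∪ {a, b} is a clique in G[A], so
-- |C ∩ A| + 2 ≤ s; and a vertex w of C ∩ B with a neighbour x in I would give an
-- induced K₁ ∪ K₂ (x, ab) in G[A] or an induced P₃ (x, w, d) in G[B], so the
-- vertices of C ∩ B have degree c + 4. Otherwise A ∩ S is a nonempty
-- independent set, B contains two nonadjacent vertices of the cycle, hence C ⊆ A
-- and C plus a vertex of A ∩ S is a clique in G[A]: c < s.
--
-- Conversely, writing the cycle as σ₀ … σ₄: if c < s, take A = C ∪ {σ₀, σ₂} (one
-- part per vertex of C, plus {σ₀, σ₂}); then G[B] is the edge σ₃σ₄ plus isolated
-- vertices. If s ≤ c and D, the set of vertices of degree c + 4, has at least
-- c − s + 2 elements, take A = (C ∖ D) ∪ {σ₀, σ₁, σ₂} with |C ∖ D| + 2 ≤ s parts;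
-- then G[B] is the clique D ∪ {σ₃, σ₄} plus the isolated vertices of I.
module Submission where

open import Defs hiding (sym)
open import Data.Nat using (ℕ; zero; suc; _+_; _∸_; _≤_; _<_; z≤n; s≤s; _≡ᵇ_; _<?_)
open import Data.Nat.Properties
open import Data.Fin as Fin using (Fin; zero; suc; toℕ; fromℕ<; punchOut)
import Data.Fin.Properties as Finₚ
open import Data.Bool using (Bool; true; false; if_then_else_; _∧_; _∨_; not)
open import Data.Bool.Properties using (∨-zeroʳ; T-≡)
open import Data.Product using (Σ; _×_; _,_; proj₁; proj₂; ∃)
open import Data.Sum using (_⊎_; inj₁; inj₂)
open import Data.Empty using (⊥; ⊥-elim)
open import Function using (_∘_; id)
open import Function.Bundles using (_⇔_; mk⇔; Equivalence)
open import Function.Properties.Equivalence using () renaming (trans to ⇔-trans)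
open import Relation.Nullary using (¬_; yes; no; does)
open import Relation.Nullary.Decidable using (dec-true; dec-false; decidable-stable)
open import Relation.Binary.PropositionalEquality

private variable
  m n : ℕ
  P P′ Q Q′ R : Fin n → Bool
  v x y : Fin n

-- Sets of vertices

infix  4 _∈_ _∉_ _⊆_
infixr 7 _∩_ _∖_
infixr 6 _∪_

_∈_ _∉_ : Fin n → (Fin n → Bool) → Set
v ∈ P = P v ≡ true
v ∉ P = P v ≡ false

_⊆_ : (Fin n → Bool) → (Fin n → Bool) → Set
P ⊆ Q = ∀ v → v ∈ P → v ∈ Q

Disjoint : (Fin n → Bool) → (Fin n → Bool) → Set
Disjoint P Q = ∀ v → v ∈ P → v ∉ Q

-- Opaque, so that a membership v ∈ P ∪ Q determines P, Q and v by unification.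
opaque
  _∪_ _∩_ _∖_ : (Fin n → Bool) → (Fin n → Bool) → Fin n → Bool
  (P ∪ Q) v = P v ∨ Q v
  (P ∩ Q) v = P v ∧ Q v
  (P ∖ Q) v = P v ∧ not (Q v)

  ⁅_⁆ : Fin n → Fin n → Bool
  ⁅ x ⁆ v = does (v Fin.≟ x)

b≡true⇒b≢false : ∀ {b} → b ≡ true → b ≢ false
b≡true⇒b≢false b≡true b≡false with () ← trans (sym b≡true) b≡false

∈⊎∉ : (P : Fin n → Bool) (v : Fin n) → v ∈ P ⊎ v ∉ P
∈⊎∉ P v with P v
... | true  = inj₁ refl
... | false = inj₂ refl

¬∈⇒∉ : ¬ v ∈ P → v ∉ P
¬∈⇒∉ {v = v} {P = P} v∉P with P v
... | true  = ⊥-elim (v∉P refl)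
... | false = refl

disjoint-⊆ : P′ ⊆ P → Q′ ⊆ Q → Disjoint P Q → Disjoint P′ Q′
disjoint-⊆ {Q′ = Q′} P′⊆P Q′⊆Q P∩Q≡∅ v v∈P′ =
  ¬∈⇒∉ {P = Q′} λ v∈Q′ → b≡true⇒b≢false (Q′⊆Q v v∈Q′) (P∩Q≡∅ v (P′⊆P v v∈P′))

opaque
  unfolding _∪_ _∩_ _∖_ ⁅_⁆

  ∪-introˡ : v ∈ P → v ∈ P ∪ Q
  ∪-introˡ v∈P rewrite v∈P = refl

  ∪-introʳ : v ∈ Q → v ∈ P ∪ Q
  ∪-introʳ {v = v} {P = P} v∈Q rewrite v∈Q = ∨-zeroʳ (P v)

  ∪-elim : v ∈ P ∪ Q → v ∈ P ⊎ v ∈ Q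
  ∪-elim {v = v} {P = P} h with P v
  ... | true  = inj₁ refl
  ... | false = inj₂ h

  ∪-∉ : v ∉ P ∪ Q → v ∉ P × v ∉ Q
  ∪-∉ {v = v} {P = P} h with P v
  ... | false = refl , h

  ∩-intro : v ∈ P → v ∈ Q → v ∈ P ∩ Q
  ∩-intro v∈P v∈Q rewrite v∈P | v∈Q = refl

  ∩-elim : v ∈ P ∩ Q → v ∈ P × v ∈ Q
  ∩-elim {v = v} {P = P} h with P v
  ... | true = refl , h

  ∖-intro : v ∈ P → v ∉ Q → v ∈ P ∖ Q
  ∖-intro v∈P v∉Q rewrite v∈P | v∉Q = refl

  ∖-elim : v ∈ P ∖ Q → v ∈ P × v ∉ Q
  ∖-elim {v = v} {P = P} {Q = Q} h with P v | Q v
  ... | true | false = refl , refl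

  ∖-∉ : v ∈ P → v ∉ P ∖ Q → v ∈ Q
  ∖-∉ {v = v} {Q = Q} v∈P h rewrite v∈P with Q v
  ... | true = refl

  ⁅⁆-refl : (x : Fin n) → x ∈ ⁅ x ⁆
  ⁅⁆-refl x = dec-true (x Fin.≟ x) refl

  ∈⁅⁆⇒≡ : v ∈ ⁅ x ⁆ → v ≡ x
  ∈⁅⁆⇒≡ {v = v} {x = x} h with v Fin.≟ x
  ... | yes v≡x = v≡x

  ≢⇒∉⁅⁆ : v ≢ x → v ∉ ⁅ x ⁆
  ≢⇒∉⁅⁆ {v = v} {x = x} = dec-false (v Fin.≟ x)

∪-⊆ : P ⊆ R → Q ⊆ R → P ∪ Q ⊆ R
∪-⊆ P⊆R Q⊆R v h with ∪-elim h
... | inj₁ v∈P = P⊆R v v∈P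
... | inj₂ v∈Q = Q⊆R v v∈Q

⊆-refl : P ⊆ P
⊆-refl _ = id

∩-⊆ˡ : P ∩ Q ⊆ P
∩-⊆ˡ _ = proj₁ ∘ ∩-elim

∩-⊆ʳ : P ∩ Q ⊆ Q
∩-⊆ʳ _ = proj₂ ∘ ∩-elim

∖-⊆ : P ∖ Q ⊆ P
∖-⊆ _ = proj₁ ∘ ∖-elim

⁅⁆-⊆ : x ∈ P → ⁅ x ⁆ ⊆ P
⁅⁆-⊆ {P = P} x∈P v v∈⁅x⁆ = subst (_∈ P) (sym (∈⁅⁆⇒≡ v∈⁅x⁆)) x∈P

⁅⁆-disjoint : x ≢ y → Disjoint ⁅ x ⁆ ⁅ y ⁆
⁅⁆-disjoint x≢y v v∈⁅x⁆ = ≢⇒∉⁅⁆ (x≢y ∘ trans (sym (∈⁅⁆⇒≡ v∈⁅x⁆)))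

∈-pair : v ∈ ⁅ x ⁆ ∪ ⁅ y ⁆ → v ≡ x ⊎ v ≡ y
∈-pair h with ∪-elim h
... | inj₁ v∈ = inj₁ (∈⁅⁆⇒≡ v∈)
... | inj₂ v∈ = inj₂ (∈⁅⁆⇒≡ v∈)

-- Counting

count-mono : {P Q : Fin n → Bool} → P ⊆ Q → count P ≤ count Q
count-mono {n = zero}  P⊆Q = z≤n
count-mono {n = suc n} {P = P} P⊆Q with P zero in P₀
... | true rewrite P⊆Q zero P₀ = s≤s (count-mono (P⊆Q ∘ suc))
... | false = ≤-trans (count-mono (P⊆Q ∘ suc)) (m≤n+m _ _)

count-≡ : P ⊆ Q → Q ⊆ P → count P ≡ count Q
count-≡ P⊆Q Q⊆P = ≤-antisym (count-mono P⊆Q) (count-mono Q⊆P)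

count-∅ : {P : Fin n → Bool} → (∀ v → ¬ v ∈ P) → count P ≡ 0
count-∅ {n = zero}  P≡∅ = refl
count-∅ {n = suc n} {P = P} P≡∅ with P zero in P₀
... | true  = ⊥-elim (P≡∅ zero P₀)
... | false = count-∅ (P≡∅ ∘ suc)

isS isI : Part → Bool
isS partS = true
isS _     = false
isI partI = true
isI _     = false

opaque
  unfolding _∪_ _∩_ _∖_

  count-∪-≤ : (P Q : Fin n → Bool) → count (P ∪ Q) ≤ count P + count Q
  count-∪-≤ {n = zero}  P Q = z≤n
  count-∪-≤ {n = suc n} P Q with P zero | Q zero | count-∪-≤ (P ∘ suc) (Q ∘ suc)
  ... | true  | true  | ih = s≤s (≤-trans ih (+-monoʳ-≤ _ (n≤1+n _)))
  ... | true  | false | ih = s≤s ih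
  ... | false | true  | ih = ≤-trans (s≤s ih) (≤-reflexive (sym (+-suc _ _)))
  ... | false | false | ih = ih

  count-∪-disjoint : {P Q : Fin n → Bool} → Disjoint P Q → count (P ∪ Q) ≡ count P + count Q
  count-∪-disjoint {n = zero} _ = refl
  count-∪-disjoint {n = suc n} {P = P} {Q = Q} P∩Q≡∅ with P zero in P₀
  ... | true rewrite P∩Q≡∅ zero P₀ = cong suc (count-∪-disjoint (P∩Q≡∅ ∘ suc))
  ... | false with Q zero
  ...   | true  = trans (cong suc (count-∪-disjoint (P∩Q≡∅ ∘ suc))) (sym (+-suc _ _))
  ...   | false = count-∪-disjoint (P∩Q≡∅ ∘ suc)

  count-split : (P Q : Fin n → Bool) → count P ≡ count (P ∩ Q) + count (P ∖ Q)
  count-split {n = zero}  P Q = refl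
  count-split {n = suc n} P Q with P zero | Q zero | count-split (P ∘ suc) (Q ∘ suc)
  ... | true  | true  | ih = cong suc ih
  ... | true  | false | ih = trans (cong suc ih) (sym (+-suc _ _))
  ... | false | _     | ih = ih

  count-by-label : (L : Fin n → Part) (P : Fin n → Bool) →
    count P ≡ count (P ∩ isC ∘ L) + count (P ∩ isS ∘ L) + count (P ∩ isI ∘ L)
  count-by-label {n = zero}  L P = refl
  count-by-label {n = suc n} L P with P zero | L zero | count-by-label (L ∘ suc) (P ∘ suc)
  ... | false | _     | ih = ih
  ... | true  | partC | ih = cong suc ih
  ... | true  | partS | ih =
    trans (cong suc ih) (cong (_+ count ((P ∘ suc) ∩ isI ∘ L ∘ suc)) (sym (+-suc _ _)))
  ... | true  | partI | ih = trans (cong suc ih) (sym (+-suc _ _))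

rank : (Fin n → Bool) → Fin n → ℕ
rank P zero    = 0
rank P (suc v) = (if P zero then 1 else 0) + rank (P ∘ suc) v

rank<count : (P : Fin n → Bool) → v ∈ P → rank P v < count P
rank<count {v = zero}  P v∈P rewrite v∈P = s≤s z≤n
rank<count {v = suc v} P v∈P = +-monoʳ-< (if P zero then 1 else 0) (rank<count (P ∘ suc) v∈P)

rank-injective : (P : Fin n → Bool) {u v : Fin n} → u ∈ P → v ∈ P → rank P u ≡ rank P v → u ≡ v
rank-injective P {zero}  {zero}  _   _   _ = refl
rank-injective P {zero}  {suc v} u∈P _   e rewrite u∈P with () ← e
rank-injective P {suc u} {zero}  _   v∈P e rewrite v∈P with () ← e
rank-injective P {suc u} {suc v} u∈P v∈P e =
  cong suc (rank-injective (P ∘ suc) u∈P v∈P (+-cancelˡ-≡ (if P zero then 1 else 0) _ _ e))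

count≤-injection : ∀ {P : Fin n → Bool} {s} (f : ∀ v → v ∈ P → Fin s) →
                   (∀ u v u∈P v∈P → f u u∈P ≡ f v v∈P → u ≡ v) → count P ≤ s
count≤-injection {n = zero} f f-inj = z≤n
count≤-injection {n = suc n} {P = P} f f-inj with P zero in P₀
... | false = count≤-injection (f ∘ suc) λ u v u∈P v∈P →
                Finₚ.suc-injective ∘ f-inj (suc u) (suc v) u∈P v∈P
count≤-injection {n = suc n} {s = zero}  f f-inj | true with () ← f zero P₀
count≤-injection {n = suc n} {s = suc s} f f-inj | true =
  s≤s (count≤-injection (λ v v∈P → punchOut (f₀≢ v v∈P)) λ u v u∈P v∈P →
    Finₚ.suc-injective ∘ f-inj (suc u) (suc v) u∈P v∈P
      ∘ Finₚ.punchOut-injective (f₀≢ u u∈P) (f₀≢ v v∈P))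
  where
    f₀≢ : ∀ v v∈P → f zero P₀ ≢ f (suc v) v∈P
    f₀≢ v v∈P f₀≡ with () ← f-inj zero (suc v) P₀ v∈P f₀≡

count-image : (f : Fin m → Fin n) → (∀ i j → f i ≡ f j → i ≡ j) →
              (∀ i → f i ∈ P) → (∀ v → v ∈ P → ∃ λ i → f i ≡ v) → count P ≡ m
count-image {m = m} {P = P} f f-inj f∈P onto =
  ≤-antisym (count≤-injection (λ v → proj₁ ∘ onto v) f⁻¹-injective)
            (Finₚ.injective⇒≤ {f = rank∘f} rank∘f-injective)
  where
    f⁻¹-injective : ∀ u v u∈P v∈P → proj₁ (onto u u∈P) ≡ proj₁ (onto v v∈P) → u ≡ v
    f⁻¹-injective u v u∈P v∈P e =
      trans (sym (proj₂ (onto u u∈P))) (trans (cong f e) (proj₂ (onto v v∈P)))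
    rank∘f : Fin m → Fin (count P)
    rank∘f i = fromℕ< (rank<count P (f∈P i))
    rank∘f-injective : ∀ {i j} → rank∘f i ≡ rank∘f j → i ≡ j
    rank∘f-injective {i} {j} e = f-inj i j (rank-injective P (f∈P i) (f∈P j)
      (Finₚ.fromℕ<-injective (rank P (f i)) (rank P (f j)) _ _ e))

count-⁅⁆ : (x : Fin n) → count ⁅ x ⁆ ≡ 1
count-⁅⁆ x = count-image {P = ⁅ x ⁆} (λ _ → x) (λ { zero zero _ → refl })
                         (λ _ → ⁅⁆-refl x) (λ _ v∈⁅x⁆ → zero , sym (∈⁅⁆⇒≡ v∈⁅x⁆))

count-pair : x ≢ y → count (⁅ x ⁆ ∪ ⁅ y ⁆) ≡ 2
count-pair {x = x} {y = y} x≢y =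
  trans (count-∪-disjoint (⁅⁆-disjoint x≢y)) (cong₂ _+_ (count-⁅⁆ x) (count-⁅⁆ y))

∈⇒0<count : v ∈ P → 0 < count P
∈⇒0<count {v = v} {P = P} v∈P =
  subst (_≤ count P) (count-⁅⁆ v) (count-mono {Q = P} (⁅⁆-⊆ {P = P} v∈P))

a+2≤s⇔c∸s+2≤b : ∀ {a b c s} → c ≡ a + b → s ≤ c → a + 2 ≤ s ⇔ c ∸ s + 2 ≤ b
a+2≤s⇔c∸s+2≤b {a} {b} {c} {s} c≡a+b s≤c = mk⇔
  (λ a+2≤s → +-cancelˡ-≤ a _ _ (begin
    a + (c ∸ s + 2)   ≡⟨ shuffle ⟩
    a + 2 + (c ∸ s)   ≤⟨ +-monoˡ-≤ (c ∸ s) a+2≤s ⟩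
    s + (c ∸ s)       ≡⟨ s+[c∸s]≡a+b ⟩
    a + b             ∎))
  (λ c∸s+2≤b → +-cancelʳ-≤ (c ∸ s) _ _ (begin
    a + 2 + (c ∸ s)   ≡⟨ shuffle ⟨
    a + (c ∸ s + 2)   ≤⟨ +-monoʳ-≤ a c∸s+2≤b ⟩
    a + b             ≡⟨ s+[c∸s]≡a+b ⟨
    s + (c ∸ s)       ∎))
  where
    open ≤-Reasoning
    shuffle : a + (c ∸ s + 2) ≡ a + 2 + (c ∸ s)
    shuffle = trans (cong (a +_) (+-comm (c ∸ s) 2)) (sym (+-assoc a 2 (c ∸ s)))
    s+[c∸s]≡a+b : s + (c ∸ s) ≡ a + b
    s+[c∸s]≡a+b = trans (m+[n∸m]≡n s≤c) c≡a+b

split-bounds : ∀ {a b c s t} → c ≡ a + b → a + 2 ≤ s → b ≤ t →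
               c < s ⊎ (s ≤ c × 2 ≤ s × c ∸ s + 2 ≤ t)
split-bounds {a} {c = c} {s} c≡a+b a+2≤s b≤t with c <? s
... | yes c<s = inj₁ c<s
... | no  c≮s = inj₂ (s≤c , m+n≤o⇒n≤o a a+2≤s ,
                      ≤-trans (Equivalence.to (a+2≤s⇔c∸s+2≤b c≡a+b s≤c) a+2≤s) b≤t)
  where
    s≤c : s ≤ c
    s≤c = ≮⇒≥ c≮s

≡ᵇ≡true⇔≡ : ∀ m n → (m ≡ᵇ n) ≡ true ⇔ m ≡ n
≡ᵇ≡true⇔≡ m n = mk⇔ (≡ᵇ⇒≡ m n ∘ Equivalence.from T-≡) (Equivalence.to T-≡ ∘ ≡⇒≡ᵇ m n)

-- Graphs

module _ {n : ℕ} (G : Graph n) where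

  Clique Independent : (Fin n → Bool) → Set
  Clique P      = ∀ u v → u ∈ P → v ∈ P → u ≢ v → Adjacent G u v
  Independent P = ∀ u v → u ∈ P → v ∈ P → ¬ Adjacent G u v

  Complete : (Fin n → Bool) → (Fin n → Bool) → Set
  Complete P Q = ∀ u v → u ∈ P → v ∈ Q → Adjacent G u v

  Adjacent-sym : ∀ {u v} → Adjacent G u v → Adjacent G v u
  Adjacent-sym {u} {v} = trans (Graph.sym G v u)

  Adjacent-irrefl : ∀ {v} → ¬ Adjacent G v v
  Adjacent-irrefl {v} a with () ← trans (sym a) (Graph.irrefl G v)

  Adjacent⇒≢ : ∀ {u v} → Adjacent G u v → u ≢ v
  Adjacent⇒≢ a refl = Adjacent-irrefl a

  clique-⊆ : ∀ {P Q} → P ⊆ Q → Clique Q → Clique P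
  clique-⊆ P⊆Q Q-clique u v u∈P v∈P = Q-clique u v (P⊆Q u u∈P) (P⊆Q v v∈P)

  complete-⊆ : ∀ {P P′ Q Q′} → P′ ⊆ P → Q′ ⊆ Q → Complete P Q → Complete P′ Q′
  complete-⊆ P′⊆P Q′⊆Q P-Q u v u∈P′ v∈Q′ = P-Q u v (P′⊆P u u∈P′) (Q′⊆Q v v∈Q′)

  clique-∪ : ∀ {P Q} → Clique P → Clique Q → Complete P Q → Clique (P ∪ Q)
  clique-∪ P-clique Q-clique P-Q u v u∈ v∈ u≢v with ∪-elim u∈ | ∪-elim v∈
  ... | inj₁ u∈P | inj₁ v∈P = P-clique u v u∈P v∈P u≢v
  ... | inj₁ u∈P | inj₂ v∈Q = P-Q u v u∈P v∈Q
  ... | inj₂ u∈Q | inj₁ v∈P = Adjacent-sym (P-Q v u v∈P u∈Q)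
  ... | inj₂ u∈Q | inj₂ v∈Q = Q-clique u v u∈Q v∈Q u≢v

  ⁅⁆-clique : ∀ x → Clique ⁅ x ⁆
  ⁅⁆-clique x u v u∈ v∈ u≢v = ⊥-elim (u≢v (trans (∈⁅⁆⇒≡ u∈) (sym (∈⁅⁆⇒≡ v∈))))

  ⁅⁆-complete : ∀ {x y} → Adjacent G x y → Complete ⁅ x ⁆ ⁅ y ⁆
  ⁅⁆-complete xy u v u∈ v∈ with refl ← ∈⁅⁆⇒≡ u∈ | refl ← ∈⁅⁆⇒≡ v∈ = xy

  pair-clique : ∀ {x y} → Adjacent G x y → Clique (⁅ x ⁆ ∪ ⁅ y ⁆)
  pair-clique {x} {y} xy = clique-∪ (⁅⁆-clique x) (⁅⁆-clique y) (⁅⁆-complete xy)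

  pair-independent : ∀ {x y} → ¬ Adjacent G x y → Independent (⁅ x ⁆ ∪ ⁅ y ⁆)
  pair-independent {x} {y} ¬xy u v u∈ v∈ with ∈-pair u∈ | ∈-pair v∈
  ... | inj₁ refl | inj₁ refl = Adjacent-irrefl
  ... | inj₁ refl | inj₂ refl = ¬xy
  ... | inj₂ refl | inj₁ refl = ¬xy ∘ Adjacent-sym
  ... | inj₂ refl | inj₂ refl = Adjacent-irrefl

  module _ {A : Fin n → Bool} {s : ℕ} (multi : CompleteMultipartiteAtMost G A s) where

    open Σ multi renaming (proj₁ to part; proj₂ to part-iff)

    multipartite-same-part : ∀ {u v} (u∈A : u ∈ A) (v∈A : v ∈ A) → u ≢ v →
                             ¬ Adjacent G u v → part u u∈A ≡ part v v∈A
    multipartite-same-part u∈A v∈A u≢v ¬uv = decidable-stable (part _ u∈A Fin.≟ part _ v∈A)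
      (¬uv ∘ Equivalence.from (part-iff _ _ u∈A v∈A u≢v))

    multipartite-coP₃-free : ∀ {a b x} → a ∈ A → b ∈ A → x ∈ A → Adjacent G a b →
                             x ≢ a → x ≢ b → ¬ Adjacent G x a → ¬ Adjacent G x b → ⊥
    multipartite-coP₃-free a∈A b∈A x∈A ab x≢a x≢b ¬xa ¬xb =
      Equivalence.to (part-iff _ _ a∈A b∈A (Adjacent⇒≢ ab)) ab
        (trans (sym (multipartite-same-part x∈A a∈A x≢a ¬xa))
               (multipartite-same-part x∈A b∈A x≢b ¬xb))

    multipartite-clique≤parts : ∀ {Q} → Q ⊆ A → Clique Q → count Q ≤ s
    multipartite-clique≤parts {Q} Q⊆A Q-clique =
      count≤-injection (λ v v∈Q → part v (Q⊆A v v∈Q)) λ u v u∈Q v∈Q same →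
        decidable-stable (u Fin.≟ v) λ u≢v →
          Equivalence.to (part-iff u v _ _ u≢v) (Q-clique u v u∈Q v∈Q u≢v) same

  cliques-P₃-free : ∀ {A a b d} → DisjointUnionOfCliques G A → a ∉ A → b ∉ A → d ∉ A →
                    Adjacent G a b → Adjacent G b d → a ≢ d → Adjacent G a d
  cliques-P₃-free (label , label-iff) a∉A b∉A d∉A ab bd a≢d =
    Equivalence.from (label-iff _ _ a∉A d∉A a≢d)
      (trans (Equivalence.to (label-iff _ _ a∉A b∉A (Adjacent⇒≢ ab)) ab)
             (Equivalence.to (label-iff _ _ b∉A d∉A (Adjacent⇒≢ bd)) bd))

  -- Parts numbered in ℕ below t, so that labellings can be shifted and combined.
  MultipartiteLabelling : (Fin n → Bool) → ℕ → Set
  MultipartiteLabelling A t =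
    Σ (Fin n → ℕ) λ part → (∀ v → v ∈ A → part v < t)
      × (∀ u v → u ∈ A → v ∈ A → u ≢ v → Adjacent G u v ⇔ (part u ≢ part v))

  labelling⇒multipartite : ∀ {A t s} → MultipartiteLabelling A t → t ≤ s →
                           CompleteMultipartiteAtMost G A s
  labelling⇒multipartite {A} {s = s} (part , part<t , part-iff) t≤s = part′ , λ u v u∈A v∈A u≢v →
    mk⇔ (λ uv same → Equivalence.to (part-iff u v u∈A v∈A u≢v) uv
                       (Finₚ.fromℕ<-injective (part u) (part v) _ _ same))
        (λ differ → Equivalence.from (part-iff u v u∈A v∈A u≢v)
                      (differ ∘ λ same → Finₚ.fromℕ<-cong (part u) (part v) same _ _))
    where
      part′ : ∀ v → v ∈ A → Fin s
      part′ v v∈A = fromℕ< (≤-trans (part<t v v∈A) t≤s)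

  independent-labelling : ∀ {J} → Independent J → MultipartiteLabelling J 1
  independent-labelling J-ind = (λ _ → 0) , (λ _ _ → s≤s z≤n) , λ u v u∈J v∈J _ →
    mk⇔ (⊥-elim ∘ J-ind u v u∈J v∈J) (λ 0≢0 → ⊥-elim (0≢0 refl))

  clique-join-labelling : ∀ {K J t} → Clique K → Complete K J → MultipartiteLabelling J t →
                          MultipartiteLabelling (K ∪ J) (count K + t)
  clique-join-labelling {K} {J} {t} K-clique K-J (part , part<t , part-iff) =
    label , label<bound , label-iff
    where
      label : Fin n → ℕ
      label v = if K v then rank K v else count K + part v

      label<bound : ∀ v → v ∈ K ∪ J → label v < count K + t
      label<bound v v∈ with K v in Kv | ∪-elim v∈
      ... | true  | _        = ≤-trans (rank<count K Kv) (m≤m+n _ t)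
      ... | false | inj₂ v∈J = +-monoʳ-< (count K) (part<t v v∈J)

      K-label<J-label : ∀ u v → u ∈ K → v ∈ J → rank K u ≢ count K + part v
      K-label<J-label u v u∈K _ e = <⇒≢ (≤-trans (rank<count K u∈K) (m≤m+n _ (part v))) e

      label-iff : ∀ u v → u ∈ K ∪ J → v ∈ K ∪ J → u ≢ v → Adjacent G u v ⇔ (label u ≢ label v)
      label-iff u v u∈ v∈ u≢v with K u in Ku | K v in Kv | ∪-elim u∈ | ∪-elim v∈
      ... | true  | true  | _ | _ =
        mk⇔ (λ _ → u≢v ∘ rank-injective K Ku Kv) (λ _ → K-clique u v Ku Kv u≢v)
      ... | true  | false | _ | inj₂ v∈J =
        mk⇔ (λ _ → K-label<J-label u v Ku v∈J) (λ _ → K-J u v Ku v∈J)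
      ... | false | true  | inj₂ u∈J | _ =
        mk⇔ (λ _ → K-label<J-label v u Kv u∈J ∘ sym) (λ _ → Adjacent-sym (K-J v u Kv u∈J))
      ... | false | false | inj₂ u∈J | inj₂ v∈J =
        mk⇔ (λ uv → Equivalence.to (part-iff u v u∈J v∈J u≢v) uv ∘ +-cancelˡ-≡ (count K) _ _)
            (λ differ → Equivalence.from (part-iff u v u∈J v∈J u≢v) (differ ∘ cong (count K +_)))

  clique+isolated⇒cliques : ∀ {A} (Q : Fin n → Bool) → Clique Q →
    (∀ u v → u ∉ A → v ∉ A → u ∉ Q → ¬ Adjacent G u v) → DisjointUnionOfCliques G A
  clique+isolated⇒cliques {A} Q Q-clique isolated = label , label-iff
    where
      label : Fin n → ℕ
      label v = if Q v then 0 else suc (toℕ v)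

      label-iff : ∀ u v → u ∉ A → v ∉ A → u ≢ v → Adjacent G u v ⇔ (label u ≡ label v)
      label-iff u v u∉A v∉A u≢v with Q u in Qu | Q v in Qv
      ... | true  | true  = mk⇔ (λ _ → refl) (λ _ → Q-clique u v Qu Qv u≢v)
      ... | true  | false = mk⇔ (⊥-elim ∘ isolated v u v∉A u∉A Qv ∘ Adjacent-sym) λ ()
      ... | false | true  = mk⇔ (⊥-elim ∘ isolated u v u∉A v∉A Qu) λ ()
      ... | false | false = mk⇔ (⊥-elim ∘ isolated u v u∉A v∉A Qu)
                                (⊥-elim ∘ u≢v ∘ Finₚ.toℕ-injective ∘ suc-injective)

-- The 5-cycle

pattern i₀ = zero
pattern i₁ = suc zero
pattern i₂ = suc (suc zero)
pattern i₃ = suc (suc (suc zero))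
pattern i₄ = suc (suc (suc (suc zero)))

prev5 : Fin 5 → Fin 5
prev5 i₀ = i₄
prev5 i₁ = i₀
prev5 i₂ = i₁
prev5 i₃ = i₂
prev5 i₄ = i₃

prev5-next5 : ∀ i → prev5 (next5 i) ≡ i
prev5-next5 i₀ = refl
prev5-next5 i₁ = refl
prev5-next5 i₂ = refl
prev5-next5 i₃ = refl
prev5-next5 i₄ = refl

next²-nonadjacent : ∀ i → ¬ C5adj i (next5 (next5 i))
next²-nonadjacent i₀ (inj₁ ())
next²-nonadjacent i₀ (inj₂ ())
next²-nonadjacent i₁ (inj₁ ())
next²-nonadjacent i₁ (inj₂ ())
next²-nonadjacent i₂ (inj₁ ())
next²-nonadjacent i₂ (inj₂ ())
next²-nonadjacent i₃ (inj₁ ())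
next²-nonadjacent i₃ (inj₂ ())
next²-nonadjacent i₄ (inj₁ ())
next²-nonadjacent i₄ (inj₂ ())

next²-≢ : ∀ i → i ≢ next5 (next5 i)
next²-≢ i₀ ()
next²-≢ i₁ ()
next²-≢ i₂ ()
next²-≢ i₃ ()
next²-≢ i₄ ()

data C5Split (f : Fin 5 → Bool) : Set where
  coP₃-true              : f i₀ ≡ true → f i₁ ≡ true → f i₃ ≡ true → C5Split f
  P₃-false               : f i₀ ≡ false → f i₁ ≡ false → f i₂ ≡ false → C5Split f
  edge-true-vertex-false : ∀ a d → f a ≡ true → f (next5 a) ≡ true → f d ≡ false → C5Split f
  vertex-true-gap-false  : ∀ a d → f a ≡ true → f d ≡ false → f (next5 (next5 d)) ≡ false →
                           C5Split f

c5-split : ∀ f → C5Split f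
c5-split f with f i₀ in e₀ | f i₁ in e₁ | f i₂ in e₂ | f i₃ in e₃ | f i₄ in e₄
... | true  | true  | true  | true  | true  = coP₃-true e₀ e₁ e₃
... | true  | true  | true  | true  | false = edge-true-vertex-false i₀ i₄ e₀ e₁ e₄
... | true  | true  | true  | false | true  = edge-true-vertex-false i₀ i₃ e₀ e₁ e₃
... | true  | true  | true  | false | false = edge-true-vertex-false i₀ i₃ e₀ e₁ e₃
... | true  | true  | false | true  | true  = edge-true-vertex-false i₀ i₂ e₀ e₁ e₂
... | true  | true  | false | true  | false = edge-true-vertex-false i₀ i₂ e₀ e₁ e₂
... | true  | true  | false | false | true  = edge-true-vertex-false i₀ i₂ e₀ e₁ e₂
... | true  | true  | false | false | false = edge-true-vertex-false i₀ i₂ e₀ e₁ e₂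
... | true  | false | true  | true  | true  = edge-true-vertex-false i₂ i₁ e₂ e₃ e₁
... | true  | false | true  | true  | false = edge-true-vertex-false i₂ i₁ e₂ e₃ e₁
... | true  | false | true  | false | true  = edge-true-vertex-false i₄ i₁ e₄ e₀ e₁
... | true  | false | true  | false | false = vertex-true-gap-false i₀ i₁ e₀ e₁ e₃
... | true  | false | false | true  | true  = edge-true-vertex-false i₃ i₁ e₃ e₄ e₁
... | true  | false | false | true  | false = vertex-true-gap-false i₀ i₂ e₀ e₂ e₄
... | true  | false | false | false | true  = edge-true-vertex-false i₄ i₁ e₄ e₀ e₁
... | true  | false | false | false | false = vertex-true-gap-false i₀ i₁ e₀ e₁ e₃
... | false | true  | true  | true  | true  = edge-true-vertex-false i₁ i₀ e₁ e₂ e₀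
... | false | true  | true  | true  | false = edge-true-vertex-false i₁ i₀ e₁ e₂ e₀
... | false | true  | true  | false | true  = edge-true-vertex-false i₁ i₀ e₁ e₂ e₀
... | false | true  | true  | false | false = edge-true-vertex-false i₁ i₀ e₁ e₂ e₀
... | false | true  | false | true  | true  = edge-true-vertex-false i₃ i₀ e₃ e₄ e₀
... | false | true  | false | true  | false = vertex-true-gap-false i₁ i₀ e₁ e₀ e₂
... | false | true  | false | false | true  = vertex-true-gap-false i₁ i₀ e₁ e₀ e₂
... | false | true  | false | false | false = vertex-true-gap-false i₁ i₀ e₁ e₀ e₂
... | false | false | true  | true  | true  = edge-true-vertex-false i₂ i₀ e₂ e₃ e₀
... | false | false | true  | true  | false = edge-true-vertex-false i₂ i₀ e₂ e₃ e₀
... | false | false | true  | false | true  = vertex-true-gap-false i₂ i₁ e₂ e₁ e₃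
... | false | false | true  | false | false = vertex-true-gap-false i₂ i₁ e₂ e₁ e₃
... | false | false | false | true  | true  = edge-true-vertex-false i₃ i₀ e₃ e₄ e₀
... | false | false | false | true  | false = vertex-true-gap-false i₃ i₀ e₃ e₀ e₂
... | false | false | false | false | true  = vertex-true-gap-false i₄ i₀ e₄ e₀ e₂
... | false | false | false | false | false = P₃-false e₀ e₁ e₂

-- Pseudo-split graphs

module PseudoSplit
  {n : ℕ} (G : Graph n) (L : Fin n → Part)
  (C-clique         : ∀ u v → L u ≡ partC → L v ≡ partC → u ≢ v → Adjacent G u v)
  (I-independent    : ∀ u v → L u ≡ partI → L v ≡ partI → ¬ Adjacent G u v)
  (σ                : Fin 5 → Fin n)
  (σ-injective      : ∀ i j → σ i ≡ σ j → i ≡ j)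
  (σ-S              : ∀ i → L (σ i) ≡ partS)
  (σ-onto-S         : ∀ v → L v ≡ partS → ∃ λ i → σ i ≡ v)
  (σ-adjacent       : ∀ i j → Adjacent G (σ i) (σ j) ⇔ C5adj i j)
  (C-complete-S     : ∀ u v → L u ≡ partC → L v ≡ partS → Adjacent G u v)
  (I-anticomplete-S : ∀ u v → L u ≡ partI → L v ≡ partS → ¬ Adjacent G u v)
  where

  Adj : Fin n → Fin n → Set
  Adj = Adjacent G

  C S I : Fin n → Bool
  C = isC ∘ L
  S = isS ∘ L
  I = isI ∘ L

  c : ℕ
  c = count C

  D : Fin n → Bool
  D v = degree G v ≡ᵇ c + 4

  NoINeighbour : Fin n → Set
  NoINeighbour v = ∀ x → L x ≡ partI → ¬ Adj v x

  ∈C : ∀ {v} → L v ≡ partC → v ∈ C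
  ∈C = cong isC

  C-label : ∀ {v} → v ∈ C → L v ≡ partC
  C-label {v} v∈C with L v
  ... | partC = refl

  S-label : ∀ {v} → v ∈ S → L v ≡ partS
  S-label {v} v∈S with L v
  ... | partS = refl

  I-label : ∀ {v} → v ∈ I → L v ≡ partI
  I-label {v} v∈I with L v
  ... | partI = refl

  I-≢-σ : ∀ {x} i → L x ≡ partI → x ≢ σ i
  I-≢-σ i Lx refl with () ← trans (sym Lx) (σ-S i)

  clique-C : Clique G C
  clique-C u v u∈C v∈C = C-clique u v (C-label u∈C) (C-label v∈C)

  complete-C-S : Complete G C S
  complete-C-S u v u∈C v∈S = C-complete-S u v (C-label u∈C) (S-label v∈S)

  C-S-disjoint : Disjoint C S
  C-S-disjoint v v∈C with L v
  ... | partC = refl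

  σ∈S : ∀ i → σ i ∈ S
  σ∈S i = cong isS (σ-S i)

  ⁅σ⁆⊆S : ∀ i → ⁅ σ i ⁆ ⊆ S
  ⁅σ⁆⊆S i = ⁅⁆-⊆ (σ∈S i)

  count-S : count S ≡ 5
  count-S = count-image σ σ-injective σ∈S (λ v → σ-onto-S v ∘ S-label)

  σ-adjacent-next : ∀ i → Adj (σ i) (σ (next5 i))
  σ-adjacent-next i = Equivalence.from (σ-adjacent i (next5 i)) (inj₁ refl)

  σ-nonadjacent-next² : ∀ i → ¬ Adj (σ i) (σ (next5 (next5 i)))
  σ-nonadjacent-next² i = next²-nonadjacent i ∘ Equivalence.to (σ-adjacent i _)

  σ-≢-next² : ∀ i → σ i ≢ σ (next5 (next5 i))
  σ-≢-next² i = next²-≢ i ∘ σ-injective i _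

  I-neighbour-C : ∀ {u v} → L u ≡ partI → Adj u v → L v ≡ partC
  I-neighbour-C {u} {v} Lu uv with L v in Lv
  ... | partC = refl
  ... | partS = ⊥-elim (I-anticomplete-S u v Lu Lv uv)
  ... | partI = ⊥-elim (I-independent u v Lu Lv uv)

  S-neighbour : ∀ {i v} → Adj (σ i) v → L v ≡ partC ⊎ v ≡ σ (next5 i) ⊎ v ≡ σ (prev5 i)
  S-neighbour {i} {v} σᵢv with L v in Lv
  ... | partC = inj₁ refl
  ... | partI = ⊥-elim (I-anticomplete-S v (σ i) Lv (σ-S i) (Adjacent-sym G σᵢv))
  ... | partS with σ-onto-S v Lv
  ...   | j , refl with Equivalence.to (σ-adjacent i j) σᵢv
  ...     | inj₁ refl = inj₂ (inj₁ refl)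
  ...     | inj₂ refl = inj₂ (inj₂ (cong σ (sym (prev5-next5 j))))

  C-neighbours : ∀ {v} → L v ≡ partC → suc (count (adj G v ∩ C)) ≡ c
  C-neighbours {v} Lv = begin
    1 + count (adj G v ∩ C)                ≡⟨ cong₂ _+_ (count-⁅⁆ v) (count-≡ ⊆nbrs nbrs⊆) ⟨
    count ⁅ v ⁆ + count (C ∖ ⁅ v ⁆)         ≡⟨ cong (_+ count (C ∖ ⁅ v ⁆)) (count-≡ ⁅v⁆⊆ ∩-⊆ʳ) ⟩
    count (C ∩ ⁅ v ⁆) + count (C ∖ ⁅ v ⁆)   ≡⟨ count-split C ⁅ v ⁆ ⟨
    c                                      ∎
    where
      open ≡-Reasoning
      nbrs⊆ : adj G v ∩ C ⊆ C ∖ ⁅ v ⁆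
      nbrs⊆ w w∈ = let (vw , w∈C) = ∩-elim w∈ in ∖-intro w∈C (≢⇒∉⁅⁆ (Adjacent⇒≢ G vw ∘ sym))
      ⊆nbrs : C ∖ ⁅ v ⁆ ⊆ adj G v ∩ C
      ⊆nbrs w w∈ = let (w∈C , w∉⁅v⁆) = ∖-elim w∈ in
        ∩-intro (C-clique v w Lv (C-label w∈C) λ { refl → b≡true⇒b≢false (⁅⁆-refl v) w∉⁅v⁆ }) w∈C
      ⁅v⁆⊆ : ⁅ v ⁆ ⊆ C ∩ ⁅ v ⁆
      ⁅v⁆⊆ w w∈ with refl ← ∈⁅⁆⇒≡ w∈ = ∩-intro (∈C Lv) w∈

  S-neighbours-of-C : ∀ {v} → L v ≡ partC → count (adj G v ∩ S) ≡ 5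
  S-neighbours-of-C {v} Lv = trans (count-≡ ∩-⊆ʳ S⊆nbrs) count-S
    where
      S⊆nbrs : S ⊆ adj G v ∩ S
      S⊆nbrs w w∈S = ∩-intro (complete-C-S v w (∈C Lv) w∈S) w∈S

  degree-C : ∀ {v} → L v ≡ partC → degree G v ≡ c + 4 + count (adj G v ∩ I)
  degree-C {v} Lv = begin
    degree G v                          ≡⟨ count-by-label L (adj G v) ⟩
    #C + count (adj G v ∩ S) + #I       ≡⟨ cong (λ k → #C + k + #I) (S-neighbours-of-C Lv) ⟩
    #C + 5 + #I                         ≡⟨ cong (_+ #I) (+-suc #C 4) ⟩
    suc #C + 4 + #I                     ≡⟨ cong (λ k → k + 4 + #I) (C-neighbours Lv) ⟩
    c + 4 + #I                          ∎
    where
      open ≡-Reasoning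
      #C #I : ℕ
      #C = count (adj G v ∩ C)
      #I = count (adj G v ∩ I)

  degree-S : ∀ {v} → L v ≡ partS → degree G v ≤ c + 2
  degree-S {v} Lv with σ-onto-S v Lv
  ... | i , refl = begin
    degree G (σ i)                  ≤⟨ count-mono nbrs ⟩
    count (C ∪ ⁅ σ⁺ ⁆ ∪ ⁅ σ⁻ ⁆)      ≤⟨ count-∪-≤ C (⁅ σ⁺ ⁆ ∪ ⁅ σ⁻ ⁆) ⟩
    c + count (⁅ σ⁺ ⁆ ∪ ⁅ σ⁻ ⁆)      ≤⟨ +-monoʳ-≤ c (count-∪-≤ ⁅ σ⁺ ⁆ ⁅ σ⁻ ⁆) ⟩
    c + (count ⁅ σ⁺ ⁆ + count ⁅ σ⁻ ⁆) ≡⟨ cong (c +_) (cong₂ _+_ (count-⁅⁆ σ⁺) (count-⁅⁆ σ⁻)) ⟩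
    c + 2                           ∎
    where
      open ≤-Reasoning
      σ⁺ σ⁻ : Fin n
      σ⁺ = σ (next5 i)
      σ⁻ = σ (prev5 i)
      nbrs : adj G (σ i) ⊆ C ∪ ⁅ σ⁺ ⁆ ∪ ⁅ σ⁻ ⁆
      nbrs w σᵢw with S-neighbour σᵢw
      ... | inj₁ Lw             = ∪-introˡ (∈C Lw)
      ... | inj₂ (inj₁ refl)    = ∪-introʳ (∪-introˡ (⁅⁆-refl _))
      ... | inj₂ (inj₂ refl)    = ∪-introʳ (∪-introʳ (⁅⁆-refl _))

  degree-I : ∀ {v} → L v ≡ partI → degree G v ≤ c
  degree-I Lv = count-mono {Q = C} λ w vw → ∈C (I-neighbour-C Lv vw)

  I-neighbours≡0⇔ : ∀ {v} → count (adj G v ∩ I) ≡ 0 ⇔ NoINeighbour v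
  I-neighbours≡0⇔ {v} = mk⇔
    (λ #≡0 x Lx vx → <⇒≢ (∈⇒0<count {P = adj G v ∩ I} (∩-intro vx (cong isI Lx))) (sym #≡0))
    (λ no-I → count-∅ {P = adj G v ∩ I} λ x x∈ →
       let (vx , x∈I) = ∩-elim x∈ in no-I x (I-label x∈I) vx)

  degree≡c+4⇔ : ∀ {v} → degree G v ≡ c + 4 ⇔ (L v ≡ partC × NoINeighbour v)
  degree≡c+4⇔ {v} = mk⇔ to from
    where
      to : degree G v ≡ c + 4 → L v ≡ partC × NoINeighbour v
      to deg with L v in Lv
      ... | partC = refl , Equivalence.to I-neighbours≡0⇔
              (+-cancelˡ-≡ (c + 4) _ 0
                (trans (sym (degree-C Lv)) (trans deg (sym (+-identityʳ _)))))
      ... | partS = ⊥-elim (m+1+n≰m (c + 2)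
              (subst (_≤ c + 2) (trans deg (sym (+-assoc c 2 2))) (degree-S Lv)))
      ... | partI = ⊥-elim (m+1+n≰m c (subst (_≤ c) deg (degree-I Lv)))
      from : L v ≡ partC × NoINeighbour v → degree G v ≡ c + 4
      from (Lv , no-I) = trans (degree-C Lv)
        (trans (cong (c + 4 +_) (Equivalence.from I-neighbours≡0⇔ no-I)) (+-identityʳ _))

  ∈D⇔ : ∀ {v} → v ∈ D ⇔ (L v ≡ partC × NoINeighbour v)
  ∈D⇔ {v} = ⇔-trans (≡ᵇ≡true⇔≡ (degree G v) (c + 4)) degree≡c+4⇔

  C∪⁅σ⁆-size : ∀ i → count (C ∪ ⁅ σ i ⁆) ≡ suc c
  C∪⁅σ⁆-size i = begin
    count (C ∪ ⁅ σ i ⁆)       ≡⟨ count-∪-disjoint (disjoint-⊆ ⊆-refl (⁅σ⁆⊆S i) C-S-disjoint) ⟩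
    c + count ⁅ σ i ⁆          ≡⟨ cong (c +_) (count-⁅⁆ (σ i)) ⟩
    c + 1                     ≡⟨ +-comm c 1 ⟩
    suc c                     ∎
    where open ≡-Reasoning

  module _ {A : Fin n → Bool} (cliques : DisjointUnionOfCliques G A) where

    gap∉A⇒C⊆A : ∀ d → σ d ∉ A → σ (next5 (next5 d)) ∉ A → C ⊆ A
    gap∉A⇒C⊆A d σd∉A σd²∉A w w∈C with ∈⊎∉ A w
    ... | inj₁ w∈A = w∈A
    ... | inj₂ w∉A = ⊥-elim (σ-nonadjacent-next² d
          (cliques-P₃-free G cliques σd∉A w∉A σd²∉A
             (Adjacent-sym G (complete-C-S w _ w∈C (σ∈S d)))
             (complete-C-S w _ w∈C (σ∈S _))
             (σ-≢-next² d)))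

  module _ {A : Fin n → Bool} {s : ℕ} (multi : CompleteMultipartiteAtMost G A s) where

    vertex∈A-C⊆A⇒c<s : ∀ a → σ a ∈ A → C ⊆ A → c < s
    vertex∈A-C⊆A⇒c<s a σa∈A C⊆A = subst (_≤ s) (C∪⁅σ⁆-size a)
      (multipartite-clique≤parts G multi
        (∪-⊆ C⊆A (⁅⁆-⊆ σa∈A))
        (clique-∪ G clique-C (⁅⁆-clique G (σ a)) (complete-⊆ G ⊆-refl (⁅σ⁆⊆S a) complete-C-S)))

    edge∈A⇒|C∩A|+2≤s : ∀ a → σ a ∈ A → σ (next5 a) ∈ A → count (C ∩ A) + 2 ≤ s
    edge∈A⇒|C∩A|+2≤s a σa∈A σa⁺∈A = subst (_≤ s) size
      (multipartite-clique≤parts G multi (∪-⊆ ∩-⊆ʳ (∪-⊆ (⁅⁆-⊆ σa∈A) (⁅⁆-⊆ σa⁺∈A)))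
        (clique-∪ G (clique-⊆ G ∩-⊆ˡ clique-C) (pair-clique G (σ-adjacent-next a))
          (complete-⊆ G ∩-⊆ˡ edge⊆S complete-C-S)))
      where
        edge : Fin n → Bool
        edge = ⁅ σ a ⁆ ∪ ⁅ σ (next5 a) ⁆
        edge⊆S : edge ⊆ S
        edge⊆S = ∪-⊆ (⁅σ⁆⊆S a) (⁅σ⁆⊆S (next5 a))
        size : count (C ∩ A ∪ edge) ≡ count (C ∩ A) + 2
        size = trans (count-∪-disjoint (disjoint-⊆ ∩-⊆ˡ edge⊆S C-S-disjoint))
                     (cong (count (C ∩ A) +_) (count-pair (Adjacent⇒≢ G (σ-adjacent-next a))))

    module _ (cliques : DisjointUnionOfCliques G A) where

      edge∈A-vertex∉A⇒C∖A⊆D : ∀ a d → σ a ∈ A → σ (next5 a) ∈ A → σ d ∉ A → C ∖ A ⊆ D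
      edge∈A-vertex∉A⇒C∖A⊆D a d σa∈A σa⁺∈A σd∉A w w∈ =
        let (w∈C , w∉A) = ∖-elim w∈ in Equivalence.from ∈D⇔ (C-label w∈C , no-I w∈C w∉A)
        where
          no-I : w ∈ C → w ∉ A → NoINeighbour w
          no-I w∈C w∉A x Lx wx with ∈⊎∉ A x
          ... | inj₁ x∈A = multipartite-coP₃-free G multi σa∈A σa⁺∈A x∈A (σ-adjacent-next a)
                  (I-≢-σ a Lx) (I-≢-σ (next5 a) Lx)
                  (I-anticomplete-S x _ Lx (σ-S a)) (I-anticomplete-S x _ Lx (σ-S (next5 a)))
          ... | inj₂ x∉A = I-anticomplete-S x (σ d) Lx (σ-S d)
                  (cliques-P₃-free G cliques x∉A w∉A σd∉A (Adjacent-sym G wx)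
                    (complete-C-S w _ w∈C (σ∈S d)) (I-≢-σ d Lx))

  polar⇒bounds : ∀ {s} → IsSInfPolar G s → c < s ⊎ (s ≤ c × 2 ≤ s × c ∸ s + 2 ≤ count D)
  polar⇒bounds {s} (A , multi , cliques) with c5-split (A ∘ σ)
  ... | coP₃-true σ₀∈A σ₁∈A σ₃∈A = ⊥-elim (multipartite-coP₃-free G multi σ₀∈A σ₁∈A σ₃∈A
          (σ-adjacent-next i₀) (σ-≢-next² i₃) (σ-≢-next² i₁ ∘ sym)
          (σ-nonadjacent-next² i₃) (σ-nonadjacent-next² i₁ ∘ Adjacent-sym G))
  ... | P₃-false σ₀∉A σ₁∉A σ₂∉A = ⊥-elim (σ-nonadjacent-next² i₀
          (cliques-P₃-free G cliques σ₀∉A σ₁∉A σ₂∉A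
             (σ-adjacent-next i₀) (σ-adjacent-next i₁) (σ-≢-next² i₀)))
  ... | vertex-true-gap-false a d σa∈A σd∉A σd²∉A =
          inj₁ (vertex∈A-C⊆A⇒c<s multi a σa∈A (gap∉A⇒C⊆A cliques d σd∉A σd²∉A))
  ... | edge-true-vertex-false a d σa∈A σa⁺∈A σd∉A =
          split-bounds (count-split C A) (edge∈A⇒|C∩A|+2≤s multi a σa∈A σa⁺∈A)
            (count-mono (edge∈A-vertex∉A⇒C∖A⊆D multi cliques a d σa∈A σa⁺∈A σd∉A))

  S₀₂ S₃₄ : Fin n → Bool
  S₀₂ = ⁅ σ i₀ ⁆ ∪ ⁅ σ i₂ ⁆
  S₃₄ = ⁅ σ i₃ ⁆ ∪ ⁅ σ i₄ ⁆

  σ₀∈S₀₂ : σ i₀ ∈ S₀₂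
  σ₀∈S₀₂ = ∪-introˡ (⁅⁆-refl _)
  σ₂∈S₀₂ : σ i₂ ∈ S₀₂
  σ₂∈S₀₂ = ∪-introʳ (⁅⁆-refl _)
  σ₃∈S₃₄ : σ i₃ ∈ S₃₄
  σ₃∈S₃₄ = ∪-introˡ (⁅⁆-refl _)
  σ₄∈S₃₄ : σ i₄ ∈ S₃₄
  σ₄∈S₃₄ = ∪-introʳ (⁅⁆-refl _)

  S₀₂⊆S : S₀₂ ⊆ S
  S₀₂⊆S = ∪-⊆ (⁅σ⁆⊆S i₀) (⁅σ⁆⊆S i₂)

  S₃₄⊆S : S₃₄ ⊆ S
  S₃₄⊆S = ∪-⊆ (⁅σ⁆⊆S i₃) (⁅σ⁆⊆S i₄)

  S₀₂-labelling : MultipartiteLabelling G S₀₂ 1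
  S₀₂-labelling = independent-labelling G (pair-independent G (σ-nonadjacent-next² i₀))

  S₃₄-clique : Clique G S₃₄
  S₃₄-clique = pair-clique G (σ-adjacent-next i₃)

  σ₁-complete-S₀₂ : Complete G ⁅ σ i₁ ⁆ S₀₂
  σ₁-complete-S₀₂ u v u∈ v∈ with refl ← ∈⁅⁆⇒≡ u∈ | ∈-pair v∈
  ... | inj₁ refl = Adjacent-sym G (σ-adjacent-next i₀)
  ... | inj₂ refl = σ-adjacent-next i₁

  c<s⇒polar : ∀ {s} → c < s → IsSInfPolar G s
  c<s⇒polar c<s =
    A , labelling⇒multipartite G (clique-join-labelling G clique-C C-S₀₂ S₀₂-labelling)
                                 (≤-trans (≤-reflexive (+-comm c 1)) c<s)
      , clique+isolated⇒cliques G S₃₄ S₃₄-clique isolated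
    where
      A : Fin n → Bool
      A = C ∪ S₀₂
      C-S₀₂ : Complete G C S₀₂
      C-S₀₂ = complete-⊆ G ⊆-refl S₀₂⊆S complete-C-S
      isolated : ∀ u v → u ∉ A → v ∉ A → u ∉ S₃₄ → ¬ Adj u v
      isolated u v u∉A v∉A u∉S₃₄ uv with L u in Lu
      ... | partC = b≡true⇒b≢false (∪-introˡ (∈C Lu)) u∉A
      ... | partI = b≡true⇒b≢false (∪-introˡ (∈C (I-neighbour-C Lu uv))) v∉A
      ... | partS with σ-onto-S u Lu
      ...   | i₀ , refl = b≡true⇒b≢false (∪-introʳ σ₀∈S₀₂) u∉A
      ...   | i₂ , refl = b≡true⇒b≢false (∪-introʳ σ₂∈S₀₂) u∉A
      ...   | i₃ , refl = b≡true⇒b≢false σ₃∈S₃₄ u∉S₃₄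
      ...   | i₄ , refl = b≡true⇒b≢false σ₄∈S₃₄ u∉S₃₄
      ...   | i₁ , refl with S-neighbour uv
      ...     | inj₁ Lv           = b≡true⇒b≢false (∪-introˡ (∈C Lv)) v∉A
      ...     | inj₂ (inj₁ refl)  = b≡true⇒b≢false (∪-introʳ σ₂∈S₀₂) v∉A
      ...     | inj₂ (inj₂ refl)  = b≡true⇒b≢false (∪-introʳ σ₀∈S₀₂) v∉A

  D⊆C : D ⊆ C
  D⊆C v = ∈C ∘ proj₁ ∘ Equivalence.to ∈D⇔

  |C∖D|+2≤s⇒polar : ∀ {s} → count (C ∖ D) + 2 ≤ s → IsSInfPolar G s
  |C∖D|+2≤s⇒polar {s} |C∖D|+2≤s =
    A , labelling⇒multipartite G A-labelling bound
      , clique+isolated⇒cliques G (D ∪ S₃₄) D∪S₃₄-clique isolated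
    where
      A : Fin n → Bool
      A = C ∖ D ∪ ⁅ σ i₁ ⁆ ∪ S₀₂
      A-labelling : MultipartiteLabelling G A (count (C ∖ D) + (count ⁅ σ i₁ ⁆ + 1))
      A-labelling = clique-join-labelling G (clique-⊆ G ∖-⊆ clique-C)
        (complete-⊆ G ∖-⊆ (∪-⊆ (⁅σ⁆⊆S i₁) S₀₂⊆S) complete-C-S)
        (clique-join-labelling G (⁅⁆-clique G (σ i₁)) σ₁-complete-S₀₂ S₀₂-labelling)
      bound : count (C ∖ D) + (count ⁅ σ i₁ ⁆ + 1) ≤ s
      bound = subst (λ k → count (C ∖ D) + (k + 1) ≤ s) (sym (count-⁅⁆ (σ i₁))) |C∖D|+2≤s
      D∪S₃₄-clique : Clique G (D ∪ S₃₄)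
      D∪S₃₄-clique = clique-∪ G (clique-⊆ G D⊆C clique-C) S₃₄-clique
                                (complete-⊆ G D⊆C S₃₄⊆S complete-C-S)
      isolated : ∀ u v → u ∉ A → v ∉ A → u ∉ D ∪ S₃₄ → ¬ Adj u v
      isolated u v u∉A v∉A u∉D∪S₃₄ uv with L u in Lu
      ... | partC with ∈⊎∉ D u
      ...   | inj₁ u∈D = b≡true⇒b≢false (∪-introˡ u∈D) u∉D∪S₃₄
      ...   | inj₂ u∉D = b≡true⇒b≢false (∪-introˡ (∖-intro (∈C Lu) u∉D)) u∉A
      isolated u v u∉A v∉A u∉D∪S₃₄ uv | partI =
        proj₂ (Equivalence.to ∈D⇔ v∈D) u Lu (Adjacent-sym G uv)
        where
          v∈D : v ∈ D
          v∈D = ∖-∉ (∈C (I-neighbour-C Lu uv)) (proj₁ (∪-∉ v∉A))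
      isolated u v u∉A v∉A u∉D∪S₃₄ uv | partS with σ-onto-S u Lu
      ... | i₀ , refl = b≡true⇒b≢false (∪-introʳ (∪-introʳ σ₀∈S₀₂)) u∉A
      ... | i₁ , refl = b≡true⇒b≢false (∪-introʳ (∪-introˡ (⁅⁆-refl _))) u∉A
      ... | i₂ , refl = b≡true⇒b≢false (∪-introʳ (∪-introʳ σ₂∈S₀₂)) u∉A
      ... | i₃ , refl = b≡true⇒b≢false (∪-introʳ σ₃∈S₃₄) u∉D∪S₃₄
      ... | i₄ , refl = b≡true⇒b≢false (∪-introʳ σ₄∈S₃₄) u∉D∪S₃₄

  c≡|C∖D|+|D| : c ≡ count (C ∖ D) + count D
  c≡|C∖D|+|D| = begin
    c                                   ≡⟨ count-split C D ⟩
    count (C ∩ D) + count (C ∖ D)       ≡⟨ cong (_+ count (C ∖ D)) (count-≡ ∩-⊆ʳ D⊆C∩D) ⟩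
    count D + count (C ∖ D)             ≡⟨ +-comm (count D) _ ⟩
    count (C ∖ D) + count D             ∎
    where
      open ≡-Reasoning
      D⊆C∩D : D ⊆ C ∩ D
      D⊆C∩D v v∈D = ∩-intro (D⊆C v v∈D) v∈D

  bounds⇒polar : ∀ {s} → c < s ⊎ (s ≤ c × 2 ≤ s × c ∸ s + 2 ≤ count D) → IsSInfPolar G s
  bounds⇒polar (inj₁ c<s) = c<s⇒polar c<s
  bounds⇒polar (inj₂ (s≤c , _ , c∸s+2≤|D|)) =
    |C∖D|+2≤s⇒polar (Equivalence.from (a+2≤s⇔c∸s+2≤b c≡|C∖D|+|D| s≤c) c∸s+2≤|D|)

  polar⇔bounds : ∀ s → IsSInfPolar G s ⇔ (c < s ⊎ (s ≤ c × 2 ≤ s × c ∸ s + 2 ≤ count D))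
  polar⇔bounds s = mk⇔ polar⇒bounds bounds⇒polar

mainTheorem1 : (s n : ℕ) (G : Graph n) (L : Fin n → Part) →
    IsImperfectPseudoSplitPartition G L →
    IsSInfPolar G s ⇔
      (count (λ v → isC (L v)) < s
       ⊎ (s ≤ count (λ v → isC (L v)) × 2 ≤ s
          × count (λ v → isC (L v)) ∸ s + 2 ≤ count (λ v → degree G v ≡ᵇ count (λ w → isC (L w)) + 4)))
mainTheorem1 s n G L (C-clique , I-independent , (σ , σ-injective , σ-S , σ-onto-S , σ-adjacent)
                     , C-complete-S , I-anticomplete-S) =
  PseudoSplit.polar⇔bounds G L C-clique I-independent σ σ-injective σ-S σ-onto-S σ-adjacent
                           C-complete-S I-anticomplete-S s
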